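{- Let $1\le\alpha\le t\le n$ be integers and $x_1,\dots,x_t,y,z$ pairwise distinct vertices. Let $\mathcal{H}=\mathcal{H}_{\alpha,t}(x_1,\dots,x_t,y,z)$ be the graph obtained as follows. Start with the graph $H$ on new vertices: columns $P_i=\{p_{i,j}:j\in[D]\}$ for $i\in[2n]$, an $F$-gadget between $p_{i,j}$ and $p_{i,j+1}$ for all $i\in[2n]$, $j\in[D-1]$, and all edges $p_{i,j}p_{i',j'}$ for $i\ne i'\in[2n]$, $j,j'\in[D]$. Add the vertices $x_1,\dots,x_t,y,z$; for each $i\in[t]$ add an $F$-gadget between $p_{i,D}$ and $x_i$; for each $i\in[n-\alpha]$ add a new vertex $r_i$, an $F$-gadget between $r_i$ and $y$, and a gadget $T(p_{n+i,D},r_i,z)$. Then: (1) $\mathrm{mcut}(\mathcal{H}) = \mathrm{mcut}(H) + (t+n-\alpha)\cdot\mathrm{mcut}(F) + (n-\alpha)\cdot \mathrm{mcut}(T)$; (2) every optimal partition $(V_1,V_2)$ of $\mathcal{H}$ with $y,z\in V_2$ satisfies $|\{x_1,\dots,x_t\}\cap V_1|\le\alpha$; (3) every partition $(V_1',V_2')$ of $\{x_1,\dots,x_t,y,z\}$ such that either $y,z\in V_2'$ and $|\{x_1,\dots,x_t\}\cap V_1'|\le\alpha$, or $y\in V_2'$ and $z\in V_1'$, can be extended to an optimal partition of $\mathcal{H}$; (4) every partition $(V_1,V_2)$ of $\mathcal{H}$ with $y,z\in V_2$ and $|\{x_1,\dots,x_t\}\cap V_1|\ge\alpha+1$ satisfies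 $|E_{\mathcal{H}}(V_1,V_2)|\le \mathrm{mcut}(\mathcal{H})-D^2$.
   Context: Fix integers $n\ge1$, $D\ge1$ and set $C = D^2\binom{2n}{2}+1$. For distinct vertices $a,b$, an $F$-gadget $F(a,b)$ is the graph consisting of $C$ paths of length 2 between $a$ and $b$, pairwise disjoint apart from $a,b$; an $F'$-gadget $F'(a,b)$ consists of $C$ paths of length 3 between $a$ and $b$, pairwise disjoint apart from $a,b$. For distinct vertices $a,b,c$, $T(a,b,c)$ consists of $a,b,c$ and $F'$-gadgets between each of the three pairs. All gadgets use fresh internal vertices. For a graph $Q$, a partition is a pair $(V_1,V_2)$ partitioning $V(Q)$ (sides may be empty), $E_Q(V_1,V_2)$ is the set of edges with one endpoint in each side, $\mathrm{mcut}(Q)$ is the maximum of $|E_Q(V_1,V_2)|$ over all partitions, and a partition is optimal if it attains this maximum. $\mathrm{mcut}(F)$, $\mathrm{mcut}(T)$ denote $\mathrm{mcut}(F(a,b))$ and $\mathrm{mcut}(T(a,b,c))$, which do not depend on the endpoints. -}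

module Defs where

open import Data.Nat using (ℕ; zero; suc; _+_; _*_; _∸_; _^_; _⊔_; _≤_)
open import Data.Nat.Combinatorics using (_C_)
open import Data.Bool using (Bool; true; false; _xor_; if_then_else_)
open import Data.List using (List; []; _∷_; _++_; map; concatMap; upTo; foldr)
open import Data.Nat.ListAction using (sum)
import Data.List.Properties as LP
import Data.Nat.Properties as NP
open import Data.Product using (_×_; _,_; proj₁; proj₂)
open import Relation.Nullary using (yes; no)
open import Relation.Binary.PropositionalEquality using (_≡_)

-- Vertices.  Vertices are labelled by lists of naturals (first entry is a
-- tag), which gives distinct ("fresh") names to all vertices of the
-- construction and decidable equality for free.

Vtx : Set
Vtx = List ℕ

_≟V_ : (u v : Vtx) → Relation.Nullary.Dec (u ≡ v)
_≟V_ = LP.≡-dec NP._≟_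

-- Gadget identifiers (used to make internal gadget vertices fresh)
Gid : Set
Gid = List ℕ

pattern col i j = 0 ∷ i ∷ j ∷ []   -- F-gadget between p_{i,j} and p_{i,j+1}
pattern fx i    = 1 ∷ i ∷ []       -- F-gadget between p_{i,D} and x_i
pattern fr i    = 2 ∷ i ∷ []       -- F-gadget between r_i and y
pattern t1 i    = 3 ∷ i ∷ []       -- F'-gadget between p_{n+i,D} and r_i
pattern t2 i    = 4 ∷ i ∷ []       -- F'-gadget between p_{n+i,D} and z
pattern t3 i    = 5 ∷ i ∷ []       -- F'-gadget between r_i and z
pattern solo k  = 6 ∷ k ∷ []       -- gadgets of the stand-alone graphs F, T

pattern p i j     = 0 ∷ i ∷ j ∷ []
pattern x i       = 1 ∷ i ∷ []
pattern y         = 2 ∷ []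
pattern z         = 3 ∷ []
pattern r i       = 4 ∷ i ∷ []
pattern mid g k s = 5 ∷ k ∷ s ∷ g       -- s-th internal vertex of k-th path of gadget g
pattern a₀        = 6 ∷ 0 ∷ []          -- auxiliary endpoints for stand-alone F, T
pattern b₀        = 6 ∷ 1 ∷ []
pattern c₀        = 6 ∷ 2 ∷ []

-- Finite graphs: a list of vertices and a list of edges (each undirected
-- edge listed exactly once; endpoints belong to the vertex list).

record Graph : Set where
  constructor graph
  field
    verts : List Vtx
    edges : List (Vtx × Vtx)
open Graph public

_∪_ : Graph → Graph → Graph
graph v e ∪ graph v' e' = graph (v ++ v') (e ++ e')

⋃ : List Graph → Graph
⋃ = foldr _∪_ (graph [] [])

[1…_] : ℕ → List ℕ
[1… m ] = map suc (upTo m)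

-- Partitions and cuts.  A partition (V₁,V₂) is given by its indicator
-- P : Vtx → Bool, with V₁ = {v | P v ≡ true}, V₂ = {v | P v ≡ false}
-- (only the values on the vertices of the graph matter).

Partition : Set
Partition = Vtx → Bool

cutEdges : Partition → List (Vtx × Vtx) → ℕ
cutEdges P []             = 0
cutEdges P ((u , v) ∷ es) = (if P u xor P v then 1 else 0) + cutEdges P es

cut : Graph → Partition → ℕ
cut G P = cutEdges P (edges G)

assign : Vtx → Bool → Partition → Partition
assign v b P u with u ≟V v
... | yes _ = b
... | no  _ = P u

partitions : List Vtx → List Partition
partitions []       = (λ _ → false) ∷ []
partitions (v ∷ vs) = concatMap (λ P → assign v false P ∷ assign v true P ∷ []) (partitions vs)

mcut : Graph → ℕ
mcut G = foldr _⊔_ 0 (map (cut G) (partitions (verts G)))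

Optimal : Graph → Partition → Set
Optimal G P = cut G P ≡ mcut G

Cst : ℕ → ℕ → ℕ
Cst n D = D ^ 2 * ((2 * n) C 2) + 1

Fgad : ℕ → ℕ → Gid → Vtx → Vtx → Graph
Fgad n D g a b =
  graph (a ∷ b ∷ map (λ k → mid g k 1) [1… Cst n D ])
        (concatMap (λ k → (a , mid g k 1) ∷ (mid g k 1 , b) ∷ []) [1… Cst n D ])

F'gad : ℕ → ℕ → Gid → Vtx → Vtx → Graph
F'gad n D g a b =
  graph (a ∷ b ∷ concatMap (λ k → mid g k 1 ∷ mid g k 2 ∷ []) [1… Cst n D ])
        (concatMap (λ k → (a , mid g k 1) ∷ (mid g k 1 , mid g k 2) ∷ (mid g k 2 , b) ∷ [])
                   [1… Cst n D ])

Tgad : ℕ → ℕ → Gid → Gid → Gid → Vtx → Vtx → Vtx → Graph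
Tgad n D g₁ g₂ g₃ a b c = F'gad n D g₁ a b ∪ (F'gad n D g₂ a c ∪ F'gad n D g₃ b c)

-- the stand-alone graphs F and T (mcut does not depend on the endpoints)
Fgraph : ℕ → ℕ → Graph
Fgraph n D = Fgad n D (solo 0) a₀ b₀

Tgraph : ℕ → ℕ → Graph
Tgraph n D = Tgad n D (solo 1) (solo 2) (solo 3) a₀ b₀ c₀

Hgraph : ℕ → ℕ → Graph
Hgraph n D =
  graph (concatMap (λ i → map (λ j → p i j) [1… D ]) [1… 2 * n ]) []
  ∪ (⋃ (concatMap (λ i → map (λ j → Fgad n D (col i j) (p i j) (p i (suc j))) [1… D ∸ 1 ])
                  [1… 2 * n ])
  ∪ graph []
      -- edges p_{i,j} p_{i',j'} for 1 ≤ i < i' ≤ 2n (i' = i + d), all j, j'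
      (concatMap (λ i → concatMap (λ d → concatMap (λ j → map (λ j' → (p i j , p (i + d) j'))
                   [1… D ]) [1… D ]) [1… 2 * n ∸ i ]) [1… 2 * n ]))

HHgraph : ℕ → ℕ → ℕ → ℕ → Graph
HHgraph n D α t =
  Hgraph n D
  ∪ (graph (y ∷ z ∷ map x [1… t ]) []
  ∪ (⋃ (map (λ i → Fgad n D (fx i) (p i D) (x i)) [1… t ])
  ∪ ⋃ (map (λ i → graph (r i ∷ []) []
                    ∪ (Fgad n D (fr i) (r i) y
                    ∪ Tgad n D (t1 i) (t2 i) (t3 i) (p (n + i) D) (r i) z))
           [1… n ∸ α ])))

countX : Partition → ℕ → ℕ
countX P t = sum (map (λ i → if P (x i) then 1 else 0) [1… t ])

module Submission where

-- Write C = D²·binom(2n,2) + 1.  Every gadget is a bundle of C parallel paths, so a partition that does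
-- not cut some gadget maximally loses at least C > D² edges, more than the edges of H between columns
-- could compensate.  Cutting all gadgets maximally puts each column P_i on one side, each x_i on the
-- side of p_{i,D}, each r_i on the side of y, and splits each triangle (p_{n+i,D}, r_i, z).  With
-- monochromatic columns H cuts D²·T·(2n − T) edges between columns, where T columns lie in V₁; this is
-- at most D²n², and falls short by at least D² unless T = n.  If y, z ∈ V₂, every p_{n+i,D} with
-- i ≤ n − α lies in V₁, so more than α of the x_i in V₁ would force T > n.  Conversely, putting column i
-- with x_i for i ≤ t and n − k further columns in V₁ (k = |{x_i} ∩ V₁| ≤ α) attains all these maxima at
-- once, which also evaluates mcut.

open import Defs
open import Data.Bool using (Bool; true; false; not; _∧_; _xor_; if_then_else_)
open import Data.Bool.Properties using (¬-not; _≟_)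
open import Data.List using (List; []; _∷_; _++_; map; concatMap; upTo; length; foldr)
import Data.List.Properties as List
open import Data.List.Membership.Propositional using (_∈_; find)
open import Data.List.Membership.Propositional.Properties
  using (∈-map⁺; ∈-map⁻; ∈-upTo⁺; ∈-upTo⁻; ∈-++⁺ˡ; ∈-++⁺ʳ; ∈-concatMap⁺)
open import Data.List.Relation.Binary.Subset.Propositional using (_⊆_)
open import Data.List.Relation.Unary.All using (All; []; _∷_; all?)
import Data.List.Relation.Unary.All as All
open import Data.List.Relation.Unary.All.Properties using (¬All⇒Any¬; concat⁺; map⁺; ++⁺)
open import Data.List.Relation.Unary.Any using (here; there)
import Data.List.Relation.Unary.Any as Any
open import Data.Nat
  using (ℕ; zero; suc; _+_; _*_; _∸_; _^_; _⊔_; _≤_; _<_; _≤′_; _≤?_; >-nonZero; ≤′-refl; ≤′-step; ∣_-_∣; z≤n; s≤s)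
open import Data.Nat.Combinatorics using (nC1≡n; nCk+nC[k+1]≡[n+1]C[k+1]) renaming (_C_ to _choose_)
open import Data.Nat.ListAction using (sum)
open import Data.Nat.ListAction.Properties using (sum-++)
open import Data.Nat.Properties hiding (_≟_)
open import Data.Nat.Tactic.RingSolver using (solve-∀)
open import Data.Product using (Σ; _×_; _,_; proj₁; proj₂; ∃-syntax)
open import Data.Sum using (_⊎_; inj₁; inj₂)
open import Function using (_∘_)
open import Relation.Binary.PropositionalEquality hiding ([_])
open import Relation.Nullary using (¬_; yes; no; does; contradiction)
open import Relation.Nullary.Decidable using (dec-true; dec-false)
open import Relation.Unary using (Decidable)

-- Sums over lists and over [1… m]

∑ : {A : Set} → List A → (A → ℕ) → ℕ
∑ xs f = sum (map f xs)

-- The body of ∑[ i ∈ xs ] extends over applications only: sums and products in it need parentheses.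
infixr 8 ∑
syntax ∑ xs (λ i → e) = ∑[ i ∈ xs ] e

+-slackˡ : ∀ {a b l A B} → a + l ≤ A → b ≤ B → a + b + l ≤ A + B
+-slackˡ {a} {b} {l} a+l≤A b≤B = ≤-trans (≤-reflexive (swap a b l)) (+-mono-≤ a+l≤A b≤B)
  where
  swap : ∀ a b l → a + b + l ≡ a + l + b
  swap = solve-∀

+-slackʳ : ∀ {a b l A B} → a ≤ A → b + l ≤ B → a + b + l ≤ A + B
+-slackʳ {a} {b} {l} a≤A b+l≤B = ≤-trans (≤-reflexive (+-assoc a b l)) (+-mono-≤ a≤A b+l≤B)

module _ {A : Set} where

  ∑-cong : ∀ (xs : List A) {f g} → (∀ {a} → a ∈ xs → f a ≡ g a) → ∑ xs f ≡ ∑ xs g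
  ∑-cong []       f≡g = refl
  ∑-cong (a ∷ xs) f≡g = cong₂ _+_ (f≡g (here refl)) (∑-cong xs (f≡g ∘ there))

  ∑-mono : ∀ (xs : List A) {f g} → (∀ {a} → a ∈ xs → f a ≤ g a) → ∑ xs f ≤ ∑ xs g
  ∑-mono []       f≤g = z≤n
  ∑-mono (a ∷ xs) f≤g = +-mono-≤ (f≤g (here refl)) (∑-mono xs (f≤g ∘ there))

  ∑-mono-slack : ∀ (xs : List A) {f g a} e → (∀ {a} → a ∈ xs → f a ≤ g a) →
                 a ∈ xs → f a + e ≤ g a → ∑ xs f + e ≤ ∑ xs g
  ∑-mono-slack (b ∷ xs) {f} e f≤g (here refl) fb+e≤gb =
    +-slackˡ {f b} fb+e≤gb (∑-mono xs (f≤g ∘ there))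
  ∑-mono-slack (b ∷ xs) {f} e f≤g (there a∈xs) fa+e≤ga =
    +-slackʳ {f b} (f≤g (here refl)) (∑-mono-slack xs e (f≤g ∘ there) a∈xs fa+e≤ga)

  ∑-const : ∀ (xs : List A) c → ∑[ _ ∈ xs ] c ≡ length xs * c
  ∑-const []       c = refl
  ∑-const (a ∷ xs) c = cong (c +_) (∑-const xs c)

  ∑-+ : ∀ (xs : List A) f g → ∑[ a ∈ xs ] (f a + g a) ≡ ∑ xs f + ∑ xs g
  ∑-+ []       f g = refl
  ∑-+ (a ∷ xs) f g = trans (cong (f a + g a +_) (∑-+ xs f g)) (+-+-interchange (f a) (g a) _ _)
    where
    +-+-interchange : ∀ k l m o → k + l + (m + o) ≡ k + m + (l + o)
    +-+-interchange = solve-∀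

  ∑-*ˡ : ∀ (xs : List A) c f → ∑[ a ∈ xs ] (c * f a) ≡ c * ∑ xs f
  ∑-*ˡ []       c f = sym (*-zeroʳ c)
  ∑-*ˡ (a ∷ xs) c f = trans (cong (c * f a +_) (∑-*ˡ xs c f)) (sym (*-distribˡ-+ c (f a) _))

  ∑-++ : ∀ (xs ys : List A) f → ∑ (xs ++ ys) f ≡ ∑ xs f + ∑ ys f
  ∑-++ xs ys f = trans (cong sum (List.map-++ f xs ys)) (sum-++ (map f xs) (map f ys))

  ∑-map : ∀ {B : Set} (g : B → A) (xs : List B) f → ∑ (map g xs) f ≡ ∑ xs (f ∘ g)
  ∑-map g xs f = cong sum (sym (List.map-∘ xs))

  ∑-concatMap : ∀ {B : Set} (h : B → List A) (xs : List B) f →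
                ∑ (concatMap h xs) f ≡ ∑[ b ∈ xs ] ∑ (h b) f
  ∑-concatMap h []       f = refl
  ∑-concatMap h (b ∷ xs) f = trans (∑-++ (h b) (concatMap h xs) f) (cong (∑ (h b) f +_) (∑-concatMap h xs f))

all-or-counterexample : ∀ {A : Set} {P : A → Set} → Decidable P → (xs : List A) →
                        All P xs ⊎ ∃[ a ] a ∈ xs × ¬ P a
all-or-counterexample P? xs with all? P? xs
... | yes all = inj₁ all
... | no ¬all = inj₂ (find (¬All⇒Any¬ P? xs ¬all))

[1…suc] : ∀ m → [1… suc m ] ≡ 1 ∷ map suc [1… m ]
[1…suc] m = cong (λ l → 1 ∷ map suc l) (sym (List.map-upTo suc m))

length-[1…] : ∀ m → length [1… m ] ≡ m
length-[1…] m = trans (List.length-map suc (upTo m)) (List.length-upTo m)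

∈-[1…]⁺ : ∀ {k m} → 1 ≤ k → k ≤ m → k ∈ [1… m ]
∈-[1…]⁺ {suc k} _ k<m = ∈-map⁺ suc (∈-upTo⁺ k<m)

∈-[1…]⁻ : ∀ {k m} → k ∈ [1… m ] → 1 ≤ k × k ≤ m
∈-[1…]⁻ k∈ with _ , k'∈ , refl ← ∈-map⁻ suc k∈ = s≤s z≤n , ∈-upTo⁻ k'∈

+-∈-[1…] : ∀ {i d m} → i ∈ [1… m ] → d ∈ [1… m ∸ i ] → i + d ∈ [1… m ]
+-∈-[1…] {i} {d} i∈ d∈ with 1≤i , i≤m ← ∈-[1…]⁻ i∈ | 1≤d , d≤m∸i ← ∈-[1…]⁻ d∈ =
  ∈-[1…]⁺ (≤-trans 1≤i (m≤m+n i d)) (≤-trans (+-monoʳ-≤ i d≤m∸i) (≤-reflexive (m+[n∸m]≡n i≤m)))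

adjacent≡⇒≡ : ∀ {A : Set} (f : ℕ → A) {j k} → j ≤ k →
              (∀ i → j ≤ i → i < k → f i ≡ f (suc i)) → f j ≡ f k
adjacent≡⇒≡ f j≤k = chain (≤⇒≤′ j≤k)
  where
  chain : ∀ {j k} → j ≤′ k → (∀ i → j ≤ i → i < k → f i ≡ f (suc i)) → f j ≡ f k
  chain ≤′-refl          _    = refl
  chain (≤′-step j≤′k) step =
    trans (chain j≤′k (λ i j≤i i<k → step i j≤i (m≤n⇒m≤1+n i<k))) (step _ (≤′⇒≤ j≤′k) ≤-refl)

∑-[1…suc] : ∀ m (f : ℕ → ℕ) → ∑[ i ∈ [1… suc m ] ] f i ≡ f 1 + ∑[ i ∈ [1… m ] ] f (suc i)
∑-[1…suc] m f = trans (cong (λ l → ∑ l f) ([1…suc] m)) (cong (f 1 +_) (∑-map suc [1… m ] f))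

∑-[1…+] : ∀ m k (f : ℕ → ℕ) →
          ∑[ i ∈ [1… m + k ] ] f i ≡ ∑[ i ∈ [1… m ] ] f i + ∑[ i ∈ [1… k ] ] f (m + i)
∑-[1…+] zero    k f = refl
∑-[1…+] (suc m) k f = begin
  ∑[ i ∈ [1… suc (m + k) ] ] f i
    ≡⟨ ∑-[1…suc] (m + k) f ⟩
  f 1 + ∑[ i ∈ [1… m + k ] ] f (suc i)
    ≡⟨ cong (f 1 +_) (∑-[1…+] m k (f ∘ suc)) ⟩
  f 1 + (∑[ i ∈ [1… m ] ] f (suc i) + ∑[ i ∈ [1… k ] ] f (suc m + i))
    ≡⟨ +-assoc (f 1) (∑[ i ∈ [1… m ] ] f (suc i)) _ ⟨
  f 1 + ∑[ i ∈ [1… m ] ] f (suc i) + ∑[ i ∈ [1… k ] ] f (suc m + i)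
    ≡⟨ cong (_+ ∑[ i ∈ [1… k ] ] f (suc m + i)) (∑-[1…suc] m f) ⟨
  ∑[ i ∈ [1… suc m ] ] f i + ∑[ i ∈ [1… k ] ] f (suc m + i)
    ∎
  where open ≡-Reasoning

∑≡m*c : ∀ m {f : ℕ → ℕ} {c} → (∀ {i} → i ∈ [1… m ] → f i ≡ c) → ∑[ i ∈ [1… m ] ] f i ≡ m * c
∑≡m*c m {c = c} f≡c =
  trans (∑-cong [1… m ] f≡c) (trans (∑-const [1… m ] c) (cong (_* c) (length-[1…] m)))

∑≤m*c : ∀ m {f : ℕ → ℕ} {c} → (∀ {i} → i ∈ [1… m ] → f i ≤ c) → ∑[ i ∈ [1… m ] ] f i ≤ m * c
∑≤m*c m {c = c} f≤c = ≤-trans (∑-mono [1… m ] f≤c) (≤-reflexive (∑≡m*c m (λ _ → refl)))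

∑+e≤m*c : ∀ m {f : ℕ → ℕ} {c i} e → (∀ {i} → i ∈ [1… m ] → f i ≤ c) →
          i ∈ [1… m ] → f i + e ≤ c → ∑[ i ∈ [1… m ] ] f i + e ≤ m * c
∑+e≤m*c m e f≤c i∈ fi+e≤c =
  ≤-trans (∑-mono-slack [1… m ] e f≤c i∈ fi+e≤c) (≤-reflexive (∑≡m*c m (λ _ → refl)))

∑-[1…]-mono-≤ : ∀ {k m} (f : ℕ → ℕ) → k ≤ m → ∑[ i ∈ [1… k ] ] f i ≤ ∑[ i ∈ [1… m ] ] f i
∑-[1…]-mono-≤ {k} {m} f k≤m = begin
  ∑[ i ∈ [1… k ] ] f i                                   ≤⟨ m≤m+n _ _ ⟩
  ∑[ i ∈ [1… k ] ] f i + ∑[ i ∈ [1… m ∸ k ] ] f (k + i) ≡⟨ ∑-[1…+] k (m ∸ k) f ⟨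
  ∑[ i ∈ [1… k + (m ∸ k) ] ] f i                         ≡⟨ cong (λ l → ∑[ i ∈ [1… l ] ] f i) (m+[n∸m]≡n k≤m) ⟩
  ∑[ i ∈ [1… m ] ] f i                                   ∎
  where open ≤-Reasoning

∑-[1…]-truncate : ∀ {k m} (f : ℕ → ℕ) → k ≤ m → (∀ {i} → k < i → i ≤ m → f i ≡ 0) →
                  ∑[ i ∈ [1… m ] ] f i ≡ ∑[ i ∈ [1… k ] ] f i
∑-[1…]-truncate {k} {m} f k≤m vanish = begin
  ∑[ i ∈ [1… m ] ] f i                                   ≡⟨ cong (λ l → ∑[ i ∈ [1… l ] ] f i) (m+[n∸m]≡n k≤m) ⟨
  ∑[ i ∈ [1… k + (m ∸ k) ] ] f i                         ≡⟨ ∑-[1…+] k (m ∸ k) f ⟩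
  ∑[ i ∈ [1… k ] ] f i + ∑[ i ∈ [1… m ∸ k ] ] f (k + i) ≡⟨ cong (∑[ i ∈ [1… k ] ] f i +_) tail≡0 ⟩
  ∑[ i ∈ [1… k ] ] f i + 0                               ≡⟨ +-identityʳ _ ⟩
  ∑[ i ∈ [1… k ] ] f i                                   ∎
  where
  open ≡-Reasoning
  tail≡0 : ∑[ i ∈ [1… m ∸ k ] ] f (k + i) ≡ 0
  tail≡0 = trans (∑≡m*c (m ∸ k) (λ i∈ → let 1≤i , i≤m∸k = ∈-[1…]⁻ i∈ in
                   vanish (m<m+n k 1≤i) (≤-trans (+-monoʳ-≤ k i≤m∸k) (≤-reflexive (m+[n∸m]≡n k≤m)))))
                 (*-zeroʳ (m ∸ k))

∑-[1…]-∸ : ∀ m → ∑[ i ∈ [1… m ] ] (m ∸ i) ≡ m choose 2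
∑-[1…]-∸ zero    = refl
∑-[1…]-∸ (suc m) = begin
  ∑[ i ∈ [1… suc m ] ] (suc m ∸ i) ≡⟨ ∑-[1…suc] m (suc m ∸_) ⟩
  m + ∑[ i ∈ [1… m ] ] (m ∸ i)     ≡⟨ cong₂ _+_ (sym (nC1≡n m)) (∑-[1…]-∸ m) ⟩
  m choose 1 + m choose 2          ≡⟨ nCk+nC[k+1]≡[n+1]C[k+1] m 1 ⟩
  suc m choose 2                   ∎
  where open ≡-Reasoning

1≤choose2 : ∀ {m} → 2 ≤ m → 1 ≤ m choose 2
1≤choose2 {suc (suc k)} (s≤s (s≤s z≤n)) = begin
  1                                 ≤⟨ s≤s z≤n ⟩
  suc k                             ≡⟨ nC1≡n (suc k) ⟨
  suc k choose 1                    ≤⟨ m≤m+n _ _ ⟩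
  suc k choose 1 + suc k choose 2   ≡⟨ nCk+nC[k+1]≡[n+1]C[k+1] (suc k) 1 ⟩
  suc (suc k) choose 2              ∎
  where open ≤-Reasoning

-- Two-colourings of [1… m]

ind : Bool → ℕ
ind b = if b then 1 else 0

trues falses : (ℕ → Bool) → ℕ → ℕ
trues  s m = ∑[ i ∈ [1… m ] ] ind (s i)
falses s m = ∑[ i ∈ [1… m ] ] ind (not (s i))

disagreements : (ℕ → Bool) → ℕ → ℕ
disagreements s m = ∑[ i ∈ [1… m ] ] ∑[ d ∈ [1… m ∸ i ] ] ind (s i xor s (i + d))

trues+falses : ∀ s m → trues s m + falses s m ≡ m
trues+falses s m = begin
  trues s m + falses s m                           ≡⟨ ∑-+ [1… m ] (ind ∘ s) (ind ∘ not ∘ s) ⟨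
  ∑[ i ∈ [1… m ] ] (ind (s i) + ind (not (s i)))   ≡⟨ ∑≡m*c m (λ {i} _ → ind+ind[not] (s i)) ⟩
  m * 1                                            ≡⟨ *-identityʳ m ⟩
  m                                                ∎
  where
  open ≡-Reasoning
  ind+ind[not] : ∀ b → ind b + ind (not b) ≡ 1
  ind+ind[not] false = refl
  ind+ind[not] true  = refl

-- The first index disagrees exactly with the later indices of the opposite colour.
disagreements≡trues*falses : ∀ s m → disagreements s m ≡ trues s m * falses s m
disagreements≡trues*falses s zero    = refl
disagreements≡trues*falses s (suc m) = begin
  disagreements s (suc m)
    ≡⟨ ∑-[1…suc] m (λ i → ∑[ d ∈ [1… suc m ∸ i ] ] ind (s i xor s (i + d))) ⟩
  ∑[ d ∈ [1… m ] ] ind (s 1 xor s' d) + disagreements s' m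
    ≡⟨ cong (∑[ d ∈ [1… m ] ] ind (s 1 xor s' d) +_) (disagreements≡trues*falses s' m) ⟩
  ∑[ d ∈ [1… m ] ] ind (s 1 xor s' d) + trues s' m * falses s' m
    ≡⟨ first-row (s 1) ⟩
  (ind (s 1) + trues s' m) * (ind (not (s 1)) + falses s' m)
    ≡⟨ cong₂ _*_ (∑-[1…suc] m (ind ∘ s)) (∑-[1…suc] m (ind ∘ not ∘ s)) ⟨
  trues s (suc m) * falses s (suc m)
    ∎
  where
  open ≡-Reasoning
  s' : ℕ → Bool
  s' = s ∘ suc
  first-row : ∀ b → ∑[ d ∈ [1… m ] ] ind (b xor s' d) + trues s' m * falses s' m
                    ≡ (ind b + trues s' m) * (ind (not b) + falses s' m)
  first-row true  = refl
  first-row false = sym (*-suc (trues s' m) (falses s' m))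

n<trues : ∀ {s : ℕ → Bool} {n t α} → t ≤ n → α < trues s t →
          All (λ i → s (n + i) ≡ true) [1… n ∸ α ] → n < trues s (2 * n)
n<trues {s} {n} {t} {α} t≤n α<T highs = begin-strict
  n                                                   ≤⟨ m≤n+m∸n n α ⟩
  α + (n ∸ α)                                         <⟨ +-monoˡ-< (n ∸ α) α<T ⟩
  trues s t + (n ∸ α)                                 ≤⟨ +-mono-≤ (∑-[1…]-mono-≤ (ind ∘ s) t≤n) high-half ⟩
  trues s n + ∑[ i ∈ [1… n ] ] ind (s (n + i))        ≡⟨ ∑-[1…+] n n (ind ∘ s) ⟨
  trues s (n + n)                                     ≡⟨ cong (trues s) (cong (n +_) (+-identityʳ n)) ⟨
  trues s (2 * n)                                     ∎
  where
  open ≤-Reasoning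
  high-half : n ∸ α ≤ ∑[ i ∈ [1… n ] ] ind (s (n + i))
  high-half = begin
    n ∸ α                                   ≡⟨ *-identityʳ (n ∸ α) ⟨
    (n ∸ α) * 1                             ≡⟨ ∑≡m*c (n ∸ α) (λ i∈ → cong ind (All.lookup highs i∈)) ⟨
    ∑[ i ∈ [1… n ∸ α ] ] ind (s (n + i))    ≤⟨ ∑-[1…]-mono-≤ (λ i → ind (s (n + i))) (m∸n≤m n α) ⟩
    ∑[ i ∈ [1… n ] ] ind (s (n + i))        ∎

m+n≡o+o⇒m*n+∣m-o∣²≡o*o : ∀ {m n o} → m + n ≡ o + o → m * n + ∣ m - o ∣ * ∣ m - o ∣ ≡ o * o
m+n≡o+o⇒m*n+∣m-o∣²≡o*o {m} {n} {o} eq with ≤-total m o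
... | inj₁ m≤o with e , refl ← m≤n⇒∃[o]m+o≡n m≤o
  rewrite ∣m-m+n∣≡n m e | +-cancelˡ-≡ m n (e + (m + e)) (trans eq (+-assoc m e (m + e)))
  = identity m e
  where
  identity : ∀ a b → a * (b + (a + b)) + b * b ≡ (a + b) * (a + b)
  identity = solve-∀
... | inj₂ o≤m with e , refl ← m≤n⇒∃[o]m+o≡n o≤m
  rewrite ∣-∣-comm (o + e) o | ∣m-m+n∣≡n o e
        | +-cancelˡ-≡ o o (e + n) (sym (trans (sym (+-assoc o e n)) eq))
  = identity e n
  where
  identity : ∀ a b → (a + b + a) * b + a * a ≡ (a + b) * (a + b)
  identity = solve-∀

-- Cuts and maximum cuts

cutEdges-++ : ∀ P es es' → cutEdges P (es ++ es') ≡ cutEdges P es + cutEdges P es'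
cutEdges-++ P []             es' = refl
cutEdges-++ P ((u , v) ∷ es) es' =
  trans (cong (ind (P u xor P v) +_) (cutEdges-++ P es es')) (sym (+-assoc (ind (P u xor P v)) _ _))

cutEdges-concatMap : ∀ {A : Set} P (h : A → List (Vtx × Vtx)) xs →
                     cutEdges P (concatMap h xs) ≡ ∑[ a ∈ xs ] cutEdges P (h a)
cutEdges-concatMap P h []       = refl
cutEdges-concatMap P h (a ∷ xs) =
  trans (cutEdges-++ P (h a) (concatMap h xs)) (cong (cutEdges P (h a) +_) (cutEdges-concatMap P h xs))

cutEdges-map : ∀ {A : Set} P (e : A → Vtx × Vtx) xs →
               cutEdges P (map e xs) ≡ ∑[ a ∈ xs ] ind (P (proj₁ (e a)) xor P (proj₂ (e a)))
cutEdges-map P e []       = refl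
cutEdges-map P e (a ∷ xs) = cong (ind (P (proj₁ (e a)) xor P (proj₂ (e a))) +_) (cutEdges-map P e xs)

cut-∪ : ∀ G G' P → cut (G ∪ G') P ≡ cut G P + cut G' P
cut-∪ G G' P = cutEdges-++ P (edges G) (edges G')

cut-⋃ : ∀ Gs P → cut (⋃ Gs) P ≡ ∑[ G ∈ Gs ] cut G P
cut-⋃ []       P = refl
cut-⋃ (G ∷ Gs) P = trans (cut-∪ G (⋃ Gs) P) (cong (cut G P +_) (cut-⋃ Gs P))

EdgesWithin : List Vtx → List (Vtx × Vtx) → Set
EdgesWithin vs = All (λ e → proj₁ e ∈ vs × proj₂ e ∈ vs)

Closed : Graph → Set
Closed G = EdgesWithin (verts G) (edges G)

EdgesWithin-mono : ∀ {vs ws es} → vs ⊆ ws → EdgesWithin vs es → EdgesWithin ws es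
EdgesWithin-mono vs⊆ws = All.map (λ (u∈ , v∈) → vs⊆ws u∈ , vs⊆ws v∈)

EdgesWithin-concatMap : ∀ {A : Set} {vs} (h : A → List (Vtx × Vtx)) {xs} →
                        (∀ {a} → a ∈ xs → EdgesWithin vs (h a)) → EdgesWithin vs (concatMap h xs)
EdgesWithin-concatMap h within = concat⁺ (map⁺ (All.tabulate within))

Closed-∪ : ∀ {G G'} → Closed G → Closed G' → Closed (G ∪ G')
Closed-∪ {G} closed closed' =
  ++⁺ (EdgesWithin-mono ∈-++⁺ˡ closed) (EdgesWithin-mono (∈-++⁺ʳ (verts G)) closed')

Closed-⋃ : ∀ {Gs} → All Closed Gs → Closed (⋃ Gs)
Closed-⋃ []                 = []
Closed-⋃ (closed ∷ closeds) = Closed-∪ closed (Closed-⋃ closeds)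

cutEdges-cong : ∀ {vs} es {P P'} → EdgesWithin vs es → (∀ {v} → v ∈ vs → P v ≡ P' v) →
                cutEdges P es ≡ cutEdges P' es
cutEdges-cong []             []                 P≡P' = refl
cutEdges-cong ((u , v) ∷ es) ((u∈ , v∈) ∷ within) P≡P' =
  cong₂ _+_ (cong₂ (λ a b → ind (a xor b)) (P≡P' u∈) (P≡P' v∈)) (cutEdges-cong es within P≡P')

partitions-complete : ∀ vs (P : Partition) →
                      ∃[ P' ] P' ∈ partitions vs × (∀ {v} → v ∈ vs → P v ≡ P' v)
partitions-complete []       P = _ , here refl , λ ()
partitions-complete (w ∷ vs) P with P' , P'∈ , P≡P' ← partitions-complete vs P =
  assign w (P w) P' , ∈-concatMap⁺ _ (Any.map (λ { refl → assigned∈ (P w) }) P'∈) , agrees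
  where
  assigned∈ : ∀ b → assign w b P' ∈ assign w false P' ∷ assign w true P' ∷ []
  assigned∈ false = here refl
  assigned∈ true  = there (here refl)
  agrees : ∀ {v} → v ∈ w ∷ vs → P v ≡ assign w (P w) P' v
  agrees {v} v∈ with v ≟V w
  agrees {v} v∈          | yes refl = refl
  agrees {v} (here v≡w)  | no v≢w   = contradiction v≡w v≢w
  agrees {v} (there v∈)  | no _     = P≡P' v∈

module _ {A : Set} (f : A → ℕ) where

  ∈⇒≤max : ∀ {a xs} → a ∈ xs → f a ≤ foldr _⊔_ 0 (map f xs)
  ∈⇒≤max {xs = b ∷ xs} (here refl) = m≤m⊔n (f b) _
  ∈⇒≤max {xs = b ∷ xs} (there a∈)  = ≤-trans (∈⇒≤max a∈) (m≤n⊔m (f b) _)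

  max≤ : ∀ {m} xs → (∀ a → f a ≤ m) → foldr _⊔_ 0 (map f xs) ≤ m
  max≤ []       f≤m = z≤n
  max≤ (a ∷ xs) f≤m = ⊔-lub (f≤m a) (max≤ xs f≤m)

cut≤mcut : ∀ {G} → Closed G → ∀ P → cut G P ≤ mcut G
cut≤mcut {G} closed P with P' , P'∈ , P≡P' ← partitions-complete (verts G) P =
  ≤-trans (≤-reflexive (cutEdges-cong (edges G) closed P≡P')) (∈⇒≤max (cut G) P'∈)

mcut≤ : ∀ {G m} → (∀ P → cut G P ≤ m) → mcut G ≤ m
mcut≤ {G} = max≤ (cut G) (partitions (verts G))

mcut≡ : ∀ {G m} → Closed G → (∀ P → cut G P ≤ m) → ∀ P → cut G P ≡ m → mcut G ≡ m
mcut≡ {G} closed cut≤m P cut≡m =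
  ≤-antisym (mcut≤ {G} cut≤m) (subst (_≤ mcut G) cut≡m (cut≤mcut closed P))

-- Cuts of short paths and triangles

ind≤1 : ∀ b → ind b ≤ 1
ind≤1 false = z≤n
ind≤1 true  = ≤-refl

path₂-cut≤2 : ∀ u v w → ind (u xor v) + (ind (v xor w) + 0) ≤ 2
path₂-cut≤2 u v w = +-mono-≤ (ind≤1 (u xor v)) (+-mono-≤ (ind≤1 (v xor w)) z≤n)

path₂-cut≡1 : ∀ u v → ind (u xor v) + (ind (v xor not u) + 0) ≡ 1
path₂-cut≡1 false false = refl
path₂-cut≡1 false true  = refl
path₂-cut≡1 true  false = refl
path₂-cut≡1 true  true  = refl

path₂-cut≡2 : ∀ u → ind (u xor not u) + (ind (not u xor u) + 0) ≡ 2
path₂-cut≡2 false = refl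
path₂-cut≡2 true  = refl

path₃-cut≤ : ∀ u v v' w → ind (u xor v) + (ind (v xor v') + (ind (v' xor w) + 0)) ≤ 2 + ind (u xor w)
path₃-cut≤ false false false false = ≤ᵇ⇒≤ _ _ _
path₃-cut≤ false false false true  = ≤ᵇ⇒≤ _ _ _
path₃-cut≤ false false true  false = ≤ᵇ⇒≤ _ _ _
path₃-cut≤ false false true  true  = ≤ᵇ⇒≤ _ _ _
path₃-cut≤ false true  false false = ≤ᵇ⇒≤ _ _ _
path₃-cut≤ false true  false true  = ≤ᵇ⇒≤ _ _ _
path₃-cut≤ false true  true  false = ≤ᵇ⇒≤ _ _ _
path₃-cut≤ false true  true  true  = ≤ᵇ⇒≤ _ _ _
path₃-cut≤ true  false false false = ≤ᵇ⇒≤ _ _ _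
path₃-cut≤ true  false false true  = ≤ᵇ⇒≤ _ _ _
path₃-cut≤ true  false true  false = ≤ᵇ⇒≤ _ _ _
path₃-cut≤ true  false true  true  = ≤ᵇ⇒≤ _ _ _
path₃-cut≤ true  true  false false = ≤ᵇ⇒≤ _ _ _
path₃-cut≤ true  true  false true  = ≤ᵇ⇒≤ _ _ _
path₃-cut≤ true  true  true  false = ≤ᵇ⇒≤ _ _ _
path₃-cut≤ true  true  true  true  = ≤ᵇ⇒≤ _ _ _

path₃-cut≡ : ∀ u w → ind (u xor not u) + (ind (not u xor not w) + (ind (not w xor w) + 0)) ≡ 2 + ind (u xor w)
path₃-cut≡ false false = refl
path₃-cut≡ false true  = refl
path₃-cut≡ true  false = refl
path₃-cut≡ true  true  = refl

triangle : Bool → Bool → Bool → ℕ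
triangle u v w = ind (u xor v) + ind (u xor w) + ind (v xor w)

triangle≤2 : ∀ u v w → triangle u v w ≤ 2
triangle≤2 false false false = z≤n
triangle≤2 false false true  = ≤-refl
triangle≤2 false true  false = ≤-refl
triangle≤2 false true  true  = ≤-refl
triangle≤2 true  false false = ≤-refl
triangle≤2 true  false true  = ≤-refl
triangle≤2 true  true  false = ≤-refl
triangle≤2 true  true  true  = z≤n

triangle-const : ∀ u → triangle u u u ≡ 0
triangle-const false = refl
triangle-const true  = refl

triangle≡2 : ∀ {u w} → u ≡ true ⊎ w ≡ true → triangle u false w ≡ 2
triangle≡2 {true}  {false} _          = refl
triangle≡2 {true}  {true}  _          = refl
triangle≡2 {false} {true}  _          = refl
triangle≡2 {false} {false} (inj₁ ())
triangle≡2 {false} {false} (inj₂ ())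

module Gadgets (n D : ℕ) where

  C : ℕ
  C = Cst n D

  cut-Fgad : ∀ g a b P → cut (Fgad n D g a b) P
             ≡ ∑[ k ∈ [1… C ] ] (ind (P a xor P (mid g k 1)) + (ind (P (mid g k 1) xor P b) + 0))
  cut-Fgad g a b P = cutEdges-concatMap P (λ k → (a , mid g k 1) ∷ (mid g k 1 , b) ∷ []) [1… C ]

  Fgad-cut≤ : ∀ g a b P → cut (Fgad n D g a b) P ≤ C * 2
  Fgad-cut≤ g a b P =
    subst (_≤ C * 2) (sym (cut-Fgad g a b P)) (∑≤m*c C (λ {k} _ → path₂-cut≤2 (P a) (P (mid g k 1)) (P b)))

  Fgad-cut+C≤ : ∀ g a b P → P a ≢ P b → cut (Fgad n D g a b) P + C ≤ C * 2
  Fgad-cut+C≤ g a b P Pa≢Pb = ≤-reflexive (begin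
    cut (Fgad n D g a b) P + C ≡⟨ cong (_+ C) (trans (cut-Fgad g a b P) (∑≡m*c C one-per-path)) ⟩
    C * 1 + C                  ≡⟨ +-comm (C * 1) C ⟩
    C + C * 1                  ≡⟨ *-suc C 1 ⟨
    C * 2                      ∎)
    where
    open ≡-Reasoning
    one-per-path : ∀ {k} → k ∈ [1… C ] → ind (P a xor P (mid g k 1)) + (ind (P (mid g k 1) xor P b) + 0) ≡ 1
    one-per-path {k} _ rewrite ¬-not (Pa≢Pb ∘ sym) = path₂-cut≡1 (P a) (P (mid g k 1))

  Fgad-cut≡ : ∀ g a b P → P a ≡ P b → (∀ k → P (mid g k 1) ≡ not (P a)) →
              cut (Fgad n D g a b) P ≡ C * 2
  Fgad-cut≡ g a b P Pa≡Pb mid≡ = trans (cut-Fgad g a b P) (∑≡m*c C two-per-path)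
    where
    two-per-path : ∀ {k} → k ∈ [1… C ] → ind (P a xor P (mid g k 1)) + (ind (P (mid g k 1) xor P b) + 0) ≡ 2
    two-per-path {k} _ rewrite mid≡ k | Pa≡Pb = path₂-cut≡2 (P b)

  cut-F'gad : ∀ g a b P → cut (F'gad n D g a b) P
              ≡ ∑[ k ∈ [1… C ] ] (ind (P a xor P (mid g k 1))
                                  + (ind (P (mid g k 1) xor P (mid g k 2)) + (ind (P (mid g k 2) xor P b) + 0)))
  cut-F'gad g a b P =
    cutEdges-concatMap P (λ k → (a , mid g k 1) ∷ (mid g k 1 , mid g k 2) ∷ (mid g k 2 , b) ∷ []) [1… C ]

  F'gad-cut≤ : ∀ g a b P → cut (F'gad n D g a b) P ≤ C * (2 + ind (P a xor P b))
  F'gad-cut≤ g a b P = subst (_≤ C * (2 + ind (P a xor P b))) (sym (cut-F'gad g a b P))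
    (∑≤m*c C (λ {k} _ → path₃-cut≤ (P a) (P (mid g k 1)) (P (mid g k 2)) (P b)))

  F'gad-cut≡ : ∀ g a b P → (∀ k → P (mid g k 1) ≡ not (P a)) → (∀ k → P (mid g k 2) ≡ not (P b)) →
               cut (F'gad n D g a b) P ≡ C * (2 + ind (P a xor P b))
  F'gad-cut≡ g a b P mid₁≡ mid₂≡ = trans (cut-F'gad g a b P) (∑≡m*c C λ {k} _ →
    subst₂ (λ u w → ind (P a xor u) + (ind (u xor w) + (ind (w xor P b) + 0)) ≡ 2 + ind (P a xor P b))
           (sym (mid₁≡ k)) (sym (mid₂≡ k)) (path₃-cut≡ (P a) (P b)))

  cut-Tgad : ∀ g₁ g₂ g₃ a b c P → cut (Tgad n D g₁ g₂ g₃ a b c) P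
             ≡ cut (F'gad n D g₁ a b) P + (cut (F'gad n D g₂ a c) P + cut (F'gad n D g₃ b c) P)
  cut-Tgad g₁ g₂ g₃ a b c P = trans (cut-∪ (F'gad n D g₁ a b) (F'gad n D g₂ a c ∪ F'gad n D g₃ b c) P)
    (cong (cut (F'gad n D g₁ a b) P +_) (cut-∪ (F'gad n D g₂ a c) (F'gad n D g₃ b c) P))

  private
    three-paths : ∀ u v w → C * (2 + u) + (C * (2 + v) + C * (2 + w)) ≡ C * (6 + (u + v + w))
    three-paths = distrib C
      where
      distrib : ∀ c u v w → c * (2 + u) + (c * (2 + v) + c * (2 + w)) ≡ c * (6 + (u + v + w))
      distrib = solve-∀

  Tgad-cut≤ : ∀ g₁ g₂ g₃ a b c P →
              cut (Tgad n D g₁ g₂ g₃ a b c) P ≤ C * (6 + triangle (P a) (P b) (P c))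
  Tgad-cut≤ g₁ g₂ g₃ a b c P = begin
    cut (Tgad n D g₁ g₂ g₃ a b c) P
      ≡⟨ cut-Tgad g₁ g₂ g₃ a b c P ⟩
    cut (F'gad n D g₁ a b) P + (cut (F'gad n D g₂ a c) P + cut (F'gad n D g₃ b c) P)
      ≤⟨ +-mono-≤ (F'gad-cut≤ g₁ a b P) (+-mono-≤ (F'gad-cut≤ g₂ a c P) (F'gad-cut≤ g₃ b c P)) ⟩
    C * (2 + ind (P a xor P b)) + (C * (2 + ind (P a xor P c)) + C * (2 + ind (P b xor P c)))
      ≡⟨ three-paths (ind (P a xor P b)) (ind (P a xor P c)) (ind (P b xor P c)) ⟩
    C * (6 + triangle (P a) (P b) (P c))
      ∎
    where open ≤-Reasoning

  Tgad-cut≤C*8 : ∀ g₁ g₂ g₃ a b c P → cut (Tgad n D g₁ g₂ g₃ a b c) P ≤ C * 8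
  Tgad-cut≤C*8 g₁ g₂ g₃ a b c P =
    ≤-trans (Tgad-cut≤ g₁ g₂ g₃ a b c P) (*-monoʳ-≤ C (+-monoʳ-≤ 6 (triangle≤2 (P a) (P b) (P c))))

  Tgad-cut+C≤ : ∀ g₁ g₂ g₃ a b c P → P a ≡ P c → P b ≡ P c →
                cut (Tgad n D g₁ g₂ g₃ a b c) P + C ≤ C * 8
  Tgad-cut+C≤ g₁ g₂ g₃ a b c P Pa≡Pc Pb≡Pc = begin
    cut (Tgad n D g₁ g₂ g₃ a b c) P + C        ≤⟨ +-mono-≤ (Tgad-cut≤ g₁ g₂ g₃ a b c P) (m≤m*n C 2) ⟩
    C * (6 + triangle (P a) (P b) (P c)) + C * 2 ≡⟨ cong (λ m → C * (6 + m) + C * 2) monochromatic ⟩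
    C * 6 + C * 2                               ≡⟨ *-distribˡ-+ C 6 2 ⟨
    C * 8                                       ∎
    where
    open ≤-Reasoning
    monochromatic : triangle (P a) (P b) (P c) ≡ 0
    monochromatic rewrite Pa≡Pc | Pb≡Pc = triangle-const (P c)

  Tgad-cut≡ : ∀ g₁ g₂ g₃ a b c P →
              (∀ k → P (mid g₁ k 1) ≡ not (P a)) → (∀ k → P (mid g₁ k 2) ≡ not (P b)) →
              (∀ k → P (mid g₂ k 1) ≡ not (P a)) → (∀ k → P (mid g₂ k 2) ≡ not (P c)) →
              (∀ k → P (mid g₃ k 1) ≡ not (P b)) → (∀ k → P (mid g₃ k 2) ≡ not (P c)) →
              cut (Tgad n D g₁ g₂ g₃ a b c) P ≡ C * (6 + triangle (P a) (P b) (P c))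
  Tgad-cut≡ g₁ g₂ g₃ a b c P m₁ m₁' m₂ m₂' m₃ m₃' = begin
    cut (Tgad n D g₁ g₂ g₃ a b c) P
      ≡⟨ cut-Tgad g₁ g₂ g₃ a b c P ⟩
    cut (F'gad n D g₁ a b) P + (cut (F'gad n D g₂ a c) P + cut (F'gad n D g₃ b c) P)
      ≡⟨ cong₂ _+_ (F'gad-cut≡ g₁ a b P m₁ m₁')
                   (cong₂ _+_ (F'gad-cut≡ g₂ a c P m₂ m₂') (F'gad-cut≡ g₃ b c P m₃ m₃')) ⟩
    C * (2 + ind (P a xor P b)) + (C * (2 + ind (P a xor P c)) + C * (2 + ind (P b xor P c)))
      ≡⟨ three-paths (ind (P a xor P b)) (ind (P a xor P c)) (ind (P b xor P c)) ⟩
    C * (6 + triangle (P a) (P b) (P c))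
      ∎
    where open ≡-Reasoning

  Fgad-closed : ∀ g a b → Closed (Fgad n D g a b)
  Fgad-closed g a b = EdgesWithin-concatMap _ {[1… C ]} λ k∈ →
    let m∈ = there (there (∈-map⁺ (λ k → mid g k 1) k∈)) in
    (here refl , m∈) ∷ (m∈ , there (here refl)) ∷ []

  F'gad-closed : ∀ g a b → Closed (F'gad n D g a b)
  F'gad-closed g a b = EdgesWithin-concatMap _ {[1… C ]} λ k∈ →
    let inner = λ k → mid g k 1 ∷ mid g k 2 ∷ []
        m₁∈   = there (there (∈-concatMap⁺ inner (Any.map (λ { refl → here refl }) k∈)))
        m₂∈   = there (there (∈-concatMap⁺ inner (Any.map (λ { refl → there (here refl) }) k∈)))
    in (here refl , m₁∈) ∷ (m₁∈ , m₂∈) ∷ (m₂∈ , there (here refl)) ∷ []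

  Tgad-closed : ∀ g₁ g₂ g₃ a b c → Closed (Tgad n D g₁ g₂ g₃ a b c)
  Tgad-closed g₁ g₂ g₃ a b c =
    Closed-∪ (F'gad-closed g₁ a b) (Closed-∪ (F'gad-closed g₂ a c) (F'gad-closed g₃ b c))

  -- The catch-all clauses give the endpoints a₀, b₀ of the gadgets solo 0 and solo 1.
  source target : Gid → Vtx
  source (col i j) = p i j
  source (fx i)    = p i D
  source (fr i)    = r i
  source (t1 i)    = p (n + i) D
  source (t2 i)    = p (n + i) D
  source (t3 i)    = r i
  source (solo 3)  = b₀
  source _         = a₀
  target (col i j) = p i (suc j)
  target (fx i)    = x i
  target (fr i)    = y
  target (t1 i)    = r i
  target (t2 i)    = z
  target (t3 i)    = z
  target (solo 2)  = c₀
  target (solo 3)  = c₀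
  target _         = b₀

  -- Colouring every internal path vertex opposite to its nearer endpoint makes every gadget cut as
  -- many edges as its endpoints allow.
  extend : Partition → Partition
  extend c (mid g k 1) = not (c (source g))
  extend c (mid g k 2) = not (c (target g))
  extend c v           = c v

  mcut-Fgraph : mcut (Fgraph n D) ≡ C * 2
  mcut-Fgraph = mcut≡ (Fgad-closed (solo 0) a₀ b₀) (Fgad-cut≤ (solo 0) a₀ b₀) (extend λ _ → false)
    (Fgad-cut≡ (solo 0) a₀ b₀ (extend λ _ → false) refl (λ _ → refl))

  mcut-Tgraph : mcut (Tgraph n D) ≡ C * 8
  mcut-Tgraph = mcut≡ (Tgad-closed (solo 1) (solo 2) (solo 3) a₀ b₀ c₀)
    (Tgad-cut≤C*8 (solo 1) (solo 2) (solo 3) a₀ b₀ c₀) P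
    (Tgad-cut≡ (solo 1) (solo 2) (solo 3) a₀ b₀ c₀ P
       (λ _ → refl) (λ _ → refl) (λ _ → refl) (λ _ → refl) (λ _ → refl) (λ _ → refl))
    where
    P : Partition
    P = extend λ { a₀ → true ; _ → false }

module HGraph (n D : ℕ) where
  open Gadgets n D public

  column : ℕ → ℕ → Graph
  column i j = Fgad n D (col i j) (p i j) (p i (suc j))

  crossEdges : List (Vtx × Vtx)
  crossEdges = concatMap (λ i → concatMap (λ d → concatMap (λ j → map (λ j' → (p i j , p (i + d) j'))
                 [1… D ]) [1… D ]) [1… 2 * n ∸ i ]) [1… 2 * n ]

  columnCut crossCut : Partition → ℕ
  columnCut P = ∑[ i ∈ [1… 2 * n ] ] ∑[ j ∈ [1… D ∸ 1 ] ] cut (column i j) P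
  crossCut  P = ∑[ i ∈ [1… 2 * n ] ] ∑[ d ∈ [1… 2 * n ∸ i ] ] ∑[ j ∈ [1… D ] ] ∑[ j' ∈ [1… D ] ]
                  ind (P (p i j) xor P (p (i + d) j'))

  cut-Hgraph : ∀ P → cut (Hgraph n D) P ≡ columnCut P + crossCut P
  cut-Hgraph P = trans (cutEdges-++ P (edges (⋃ columns)) crossEdges) (cong₂ _+_ columnPart crossPart)
    where
    columns = concatMap (λ i → map (column i) [1… D ∸ 1 ]) [1… 2 * n ]
    columnPart : cut (⋃ columns) P ≡ columnCut P
    columnPart = trans (cut-⋃ columns P) (trans (∑-concatMap _ [1… 2 * n ] (λ G → cut G P))
                   (∑-cong [1… 2 * n ] λ {i} _ → ∑-map (column i) [1… D ∸ 1 ] (λ G → cut G P)))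
    crossPart : cutEdges P crossEdges ≡ crossCut P
    crossPart =
      trans (cutEdges-concatMap P _ [1… 2 * n ]) (∑-cong [1… 2 * n ] λ {i} _ →
      trans (cutEdges-concatMap P _ [1… 2 * n ∸ i ]) (∑-cong [1… 2 * n ∸ i ] λ {d} _ →
      trans (cutEdges-concatMap P _ [1… D ]) (∑-cong [1… D ] λ {j} _ →
      cutEdges-map P (λ j' → (p i j , p (i + d) j')) [1… D ])))

  maxColumnCut : ℕ
  maxColumnCut = 2 * n * ((D ∸ 1) * (C * 2))

  private
    column-cut≤ : ∀ P {i} → i ∈ [1… 2 * n ] → ∑[ j ∈ [1… D ∸ 1 ] ] cut (column i j) P ≤ (D ∸ 1) * (C * 2)
    column-cut≤ P {i} _ = ∑≤m*c (D ∸ 1) λ {j} _ → Fgad-cut≤ (col i j) (p i j) (p i (suc j)) P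

  columnCut≤ : ∀ P → columnCut P ≤ maxColumnCut
  columnCut≤ P = ∑≤m*c (2 * n) (column-cut≤ P)

  columnCut+C≤ : ∀ P {i j} → i ∈ [1… 2 * n ] → j ∈ [1… D ∸ 1 ] → P (p i j) ≢ P (p i (suc j)) →
                 columnCut P + C ≤ maxColumnCut
  columnCut+C≤ P {i} {j} i∈ j∈ P≢ =
    ∑+e≤m*c (2 * n) C (column-cut≤ P) i∈
      (∑+e≤m*c (D ∸ 1) C (λ {j} _ → Fgad-cut≤ (col i j) (p i j) (p i (suc j)) P) j∈
        (Fgad-cut+C≤ (col i j) (p i j) (p i (suc j)) P P≢))

  columnCut≡ : ∀ P → (∀ {i j} → P (p i j) ≡ P (p i (suc j))) →
               (∀ {i j k} → P (mid (col i j) k 1) ≡ not (P (p i j))) → columnCut P ≡ maxColumnCut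
  columnCut≡ P P≡ mid≡ = ∑≡m*c (2 * n) λ {i} _ → ∑≡m*c (D ∸ 1) λ {j} _ →
    Fgad-cut≡ (col i j) (p i j) (p i (suc j)) P P≡ (λ _ → mid≡)

  crossCut≤ : ∀ P → crossCut P ≤ D ^ 2 * (2 * n choose 2)
  crossCut≤ P = begin
    crossCut P
      ≤⟨ ∑-mono [1… 2 * n ] (λ {i} _ → ∑-mono [1… 2 * n ∸ i ] λ _ → ∑≤m*c D λ _ → ∑≤m*c D λ _ → ind≤1 _) ⟩
    ∑[ i ∈ [1… 2 * n ] ] ∑[ _ ∈ [1… 2 * n ∸ i ] ] D ^ 2
      ≡⟨ ∑-cong [1… 2 * n ] (λ {i} _ → trans (∑≡m*c (2 * n ∸ i) (λ _ → refl)) (*-comm (2 * n ∸ i) (D ^ 2))) ⟩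
    ∑[ i ∈ [1… 2 * n ] ] (D ^ 2 * (2 * n ∸ i))
      ≡⟨ ∑-*ˡ [1… 2 * n ] (D ^ 2) (2 * n ∸_) ⟩
    D ^ 2 * ∑[ i ∈ [1… 2 * n ] ] (2 * n ∸ i)
      ≡⟨ cong (D ^ 2 *_) (∑-[1…]-∸ (2 * n)) ⟩
    D ^ 2 * (2 * n choose 2)
      ∎
    where open ≤-Reasoning

  ColumnsMonochromatic : Partition → Set
  ColumnsMonochromatic P = ∀ {i j} → i ∈ [1… 2 * n ] → j ∈ [1… D ] → P (p i j) ≡ P (p i D)

  colourOf : Partition → ℕ → Bool
  colourOf P i = P (p i D)

  crossCut-monochromatic : ∀ P → ColumnsMonochromatic P →
                           crossCut P ≡ D ^ 2 * disagreements (colourOf P) (2 * n)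
  crossCut-monochromatic P mono = begin
    crossCut P
      ≡⟨ ∑-cong [1… 2 * n ] (λ {i} i∈ → ∑-cong [1… 2 * n ∸ i ] λ d∈ → ∑≡m*c D λ j∈ → ∑≡m*c D λ j'∈ →
           cong₂ (λ u v → ind (u xor v)) (mono i∈ j∈) (mono (+-∈-[1…] i∈ d∈) j'∈)) ⟩
    ∑[ i ∈ [1… 2 * n ] ] ∑[ d ∈ [1… 2 * n ∸ i ] ] (D * (D * ind (s i xor s (i + d))))
      ≡⟨ ∑-cong [1… 2 * n ] (λ {i} _ → ∑-*ˡ [1… 2 * n ∸ i ] D _) ⟩
    ∑[ i ∈ [1… 2 * n ] ] (D * ∑[ d ∈ [1… 2 * n ∸ i ] ] (D * ind (s i xor s (i + d))))
      ≡⟨ ∑-cong [1… 2 * n ] (λ {i} _ → cong (D *_) (∑-*ˡ [1… 2 * n ∸ i ] D _)) ⟩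
    ∑[ i ∈ [1… 2 * n ] ] (D * (D * ∑[ d ∈ [1… 2 * n ∸ i ] ] ind (s i xor s (i + d))))
      ≡⟨ trans (∑-*ˡ [1… 2 * n ] D _) (cong (D *_) (∑-*ˡ [1… 2 * n ] D _)) ⟩
    D * (D * disagreements s (2 * n))
      ≡⟨ *-assoc D D _ ⟨
    D * D * disagreements s (2 * n)
      ≡⟨ cong (λ m → D * m * disagreements s (2 * n)) (*-identityʳ D) ⟨
    D ^ 2 * disagreements s (2 * n)
      ∎
    where
    open ≡-Reasoning
    s = colourOf P

  monochromatic-or-defect :
    ∀ P → ColumnsMonochromatic P
        ⊎ ∃[ i ] ∃[ j ] i ∈ [1… 2 * n ] × j ∈ [1… D ∸ 1 ] × P (p i j) ≢ P (p i (suc j))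
  monochromatic-or-defect P
    with all-or-counterexample (λ i → all? (λ j → P (p i j) ≟ P (p i (suc j))) [1… D ∸ 1 ]) [1… 2 * n ]
  ... | inj₁ columns = inj₁ λ {i} i∈ j∈ →
    let 1≤j , j≤D = ∈-[1…]⁻ j∈ in
    adjacent≡⇒≡ (λ j → P (p i j)) j≤D λ k j≤k k<D →
      All.lookup (All.lookup columns i∈) (∈-[1…]⁺ (≤-trans 1≤j j≤k) (∸-monoˡ-≤ 1 k<D))
  ... | inj₂ (i , i∈ , ¬column) = inj₂ (i , proj₁ defect , i∈ , proj₂ defect)
    where
    defect : ∃[ j ] j ∈ [1… D ∸ 1 ] × P (p i j) ≢ P (p i (suc j))
    defect = find (¬All⇒Any¬ (λ j → P (p i j) ≟ P (p i (suc j))) [1… D ∸ 1 ] ¬column)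

  Hmax : ℕ
  Hmax = D ^ 2 * (n * n) + maxColumnCut

  trues+falses≡n+n : ∀ P → trues (colourOf P) (2 * n) + falses (colourOf P) (2 * n) ≡ n + n
  trues+falses≡n+n P = trans (trues+falses (colourOf P) (2 * n)) (cong (n +_) (+-identityʳ n))

  -- A defect in a column costs C, more than all the edges between the columns together.
  Hgraph-cut+D²≤-defect : 1 ≤ n → ∀ P {i j} → i ∈ [1… 2 * n ] → j ∈ [1… D ∸ 1 ] →
                          P (p i j) ≢ P (p i (suc j)) → cut (Hgraph n D) P + D ^ 2 ≤ Hmax
  Hgraph-cut+D²≤-defect 1≤n P i∈ j∈ P≢ = begin
    cut (Hgraph n D) P + D ^ 2
      ≡⟨ cong (_+ D ^ 2) (cut-Hgraph P) ⟩
    columnCut P + crossCut P + D ^ 2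
      ≤⟨ +-mono-≤ (+-monoʳ-≤ (columnCut P) (crossCut≤ P)) (m≤n+m _ 1) ⟩
    columnCut P + D ^ 2 * (2 * n choose 2) + (1 + D ^ 2)
      ≡⟨ regroup (columnCut P) (D ^ 2 * (2 * n choose 2)) (D ^ 2) ⟩
    columnCut P + C + D ^ 2
      ≤⟨ +-mono-≤ (columnCut+C≤ P i∈ j∈ P≢) (m≤m*n (D ^ 2) (n * n) {{>-nonZero (*-mono-≤ 1≤n 1≤n)}}) ⟩
    maxColumnCut + D ^ 2 * (n * n)
      ≡⟨ +-comm maxColumnCut _ ⟩
    Hmax
      ∎
    where
    open ≤-Reasoning
    regroup : ∀ a b c → a + b + (1 + c) ≡ a + (b + 1) + c
    regroup = solve-∀

  Hgraph-cut+D²e²≤-monochromatic :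
    ∀ P → ColumnsMonochromatic P → let e = ∣ trues (colourOf P) (2 * n) - n ∣ in
    cut (Hgraph n D) P + D ^ 2 * (e * e) ≤ Hmax
  Hgraph-cut+D²e²≤-monochromatic P mono = begin
    cut (Hgraph n D) P + D ^ 2 * (e * e)
      ≡⟨ cong (_+ D ^ 2 * (e * e)) (trans (cut-Hgraph P) (cong (columnCut P +_) (crossCut-monochromatic P mono))) ⟩
    columnCut P + D ^ 2 * disagreements s (2 * n) + D ^ 2 * (e * e)
      ≡⟨ cong (λ m → columnCut P + D ^ 2 * m + D ^ 2 * (e * e)) (disagreements≡trues*falses s (2 * n)) ⟩
    columnCut P + D ^ 2 * (T * F) + D ^ 2 * (e * e)
      ≡⟨ +-assoc (columnCut P) _ _ ⟩
    columnCut P + (D ^ 2 * (T * F) + D ^ 2 * (e * e))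
      ≡⟨ cong (columnCut P +_) (*-distribˡ-+ (D ^ 2) (T * F) (e * e)) ⟨
    columnCut P + D ^ 2 * (T * F + e * e)
      ≡⟨ cong (λ m → columnCut P + D ^ 2 * m) (m+n≡o+o⇒m*n+∣m-o∣²≡o*o {T} {F} {n} (trues+falses≡n+n P)) ⟩
    columnCut P + D ^ 2 * (n * n)
      ≤⟨ +-monoˡ-≤ _ (columnCut≤ P) ⟩
    maxColumnCut + D ^ 2 * (n * n)
      ≡⟨ +-comm maxColumnCut _ ⟩
    Hmax
      ∎
    where
    open ≤-Reasoning
    s = colourOf P
    T = trues s (2 * n)
    F = falses s (2 * n)
    e = ∣ T - n ∣

  Hgraph-cut+D²≤-unbalanced : ∀ P → ColumnsMonochromatic P → n < trues (colourOf P) (2 * n) →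
                              cut (Hgraph n D) P + D ^ 2 ≤ Hmax
  Hgraph-cut+D²≤-unbalanced P mono n<T =
    ≤-trans (+-monoʳ-≤ _ (m≤m*n (D ^ 2) (e * e) {{>-nonZero (*-mono-≤ 1≤e 1≤e)}}))
            (Hgraph-cut+D²e²≤-monochromatic P mono)
    where
    e = ∣ trues (colourOf P) (2 * n) - n ∣
    1≤e : 1 ≤ e
    1≤e = n≢0⇒n>0 λ e≡0 → <⇒≢ n<T (sym (∣m-n∣≡0⇒m≡n e≡0))

  Hgraph-cut≤ : 1 ≤ n → ∀ P → cut (Hgraph n D) P ≤ Hmax
  Hgraph-cut≤ 1≤n P with monochromatic-or-defect P
  ... | inj₁ mono                   = ≤-trans (m≤m+n _ _) (Hgraph-cut+D²e²≤-monochromatic P mono)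
  ... | inj₂ (_ , _ , i∈ , j∈ , P≢) = ≤-trans (m≤m+n _ _) (Hgraph-cut+D²≤-defect 1≤n P i∈ j∈ P≢)

  Hgraph-cut≡ : ∀ P → (∀ i j → P (p i j) ≡ P (p i D)) →
                (∀ {i j k} → P (mid (col i j) k 1) ≡ not (P (p i j))) →
                trues (colourOf P) (2 * n) ≡ n → cut (Hgraph n D) P ≡ Hmax
  Hgraph-cut≡ P P≡ mid≡ T≡n = begin
    cut (Hgraph n D) P
      ≡⟨ cut-Hgraph P ⟩
    columnCut P + crossCut P
      ≡⟨ cong₂ _+_ (columnCut≡ P (trans (P≡ _ _) (sym (P≡ _ _))) mid≡) (crossCut-monochromatic P (λ _ _ → P≡ _ _)) ⟩
    maxColumnCut + D ^ 2 * disagreements s (2 * n)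
      ≡⟨ cong (λ m → maxColumnCut + D ^ 2 * m) (trans (disagreements≡trues*falses s (2 * n)) (cong₂ _*_ T≡n F≡n)) ⟩
    maxColumnCut + D ^ 2 * (n * n)
      ≡⟨ +-comm maxColumnCut _ ⟩
    Hmax
      ∎
    where
    open ≡-Reasoning
    s = colourOf P
    F≡n : falses s (2 * n) ≡ n
    F≡n = +-cancelˡ-≡ n _ n (trans (cong (_+ falses s (2 * n)) (sym T≡n)) (trues+falses≡n+n P))

  private
    columnVertices : List Vtx
    columnVertices = concatMap (λ i → map (λ j → p i j) [1… D ]) [1… 2 * n ]

    vertex∈ : ∀ {i j} → i ∈ [1… 2 * n ] → j ∈ [1… D ] → p i j ∈ columnVertices
    vertex∈ i∈ j∈ = ∈-concatMap⁺ _ (Any.map (λ { refl → ∈-map⁺ _ j∈ }) i∈)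

  Hgraph-closed : Closed (Hgraph n D)
  Hgraph-closed = ++⁺ (EdgesWithin-mono (λ v∈ → ∈-++⁺ʳ columnVertices (∈-++⁺ˡ v∈)) (Closed-⋃ columns-closed))
                      (EdgesWithin-mono ∈-++⁺ˡ crossEdges-within)
    where
    columns-closed = concat⁺ (map⁺ (All.universal (λ i → map⁺ (All.universal (λ j →
                       Fgad-closed (col i j) (p i j) (p i (suc j))) [1… D ∸ 1 ])) [1… 2 * n ]))
    crossEdges-within =
      EdgesWithin-concatMap _ {[1… 2 * n ]} λ i∈ → EdgesWithin-concatMap _ λ d∈ → EdgesWithin-concatMap _ λ j∈ →
        map⁺ (All.tabulate λ j'∈ → vertex∈ i∈ j∈ , vertex∈ (+-∈-[1…] i∈ d∈) j'∈)

module HHGraph (n D α t : ℕ) where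
  open HGraph n D public

  xGadget rGadget tGadget : ℕ → Graph
  xGadget i = Fgad n D (fx i) (p i D) (x i)
  rGadget i = Fgad n D (fr i) (r i) y
  tGadget i = Tgad n D (t1 i) (t2 i) (t3 i) (p (n + i) D) (r i) z

  yGadget : ℕ → Graph
  yGadget i = graph (r i ∷ []) [] ∪ (rGadget i ∪ tGadget i)

  xCut yCut : Partition → ℕ
  xCut P = ∑[ i ∈ [1… t ] ] cut (xGadget i) P
  yCut P = ∑[ i ∈ [1… n ∸ α ] ] (cut (rGadget i) P + cut (tGadget i) P)

  xMax yMax HHmax : ℕ
  xMax  = t * (C * 2)
  yMax  = (n ∸ α) * (C * 2 + C * 8)
  HHmax = Hmax + (xMax + yMax)

  cut-HHgraph : ∀ P → cut (HHgraph n D α t) P ≡ cut (Hgraph n D) P + (xCut P + yCut P)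
  cut-HHgraph P =
    trans (cutEdges-++ P (edges (Hgraph n D)) (edges (⋃ xGadgets) ++ edges (⋃ yGadgets)))
      (cong (cut (Hgraph n D) P +_) (trans (cutEdges-++ P (edges (⋃ xGadgets)) (edges (⋃ yGadgets))) (cong₂ _+_
        (trans (cut-⋃ xGadgets P) (∑-map xGadget [1… t ] (λ G → cut G P)))
        (trans (cut-⋃ yGadgets P) (trans (∑-map yGadget [1… n ∸ α ] (λ G → cut G P))
          (∑-cong [1… n ∸ α ] λ {i} _ → cut-∪ (rGadget i) (tGadget i) P))))))
    where
    xGadgets yGadgets : List Graph
    xGadgets = map xGadget [1… t ]
    yGadgets = map yGadget [1… n ∸ α ]

  xCut≤ : ∀ P → xCut P ≤ xMax
  xCut≤ P = ∑≤m*c t λ {i} _ → Fgad-cut≤ (fx i) (p i D) (x i) P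

  yGadget-cut≤ : ∀ P {i} → i ∈ [1… n ∸ α ] → cut (rGadget i) P + cut (tGadget i) P ≤ C * 2 + C * 8
  yGadget-cut≤ P {i} _ =
    +-mono-≤ (Fgad-cut≤ (fr i) (r i) y P) (Tgad-cut≤C*8 (t1 i) (t2 i) (t3 i) (p (n + i) D) (r i) z P)

  yCut≤ : ∀ P → yCut P ≤ yMax
  yCut≤ P = ∑≤m*c (n ∸ α) (yGadget-cut≤ P)

  HHgraph-cut≤ : 1 ≤ n → ∀ P → cut (HHgraph n D α t) P ≤ HHmax
  HHgraph-cut≤ 1≤n P = subst (_≤ HHmax) (sym (cut-HHgraph P))
    (+-mono-≤ (Hgraph-cut≤ 1≤n P) (+-mono-≤ (xCut≤ P) (yCut≤ P)))

  module _ (P : Partition) {l : ℕ} where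

    loss-in-H : cut (Hgraph n D) P + l ≤ Hmax → cut (HHgraph n D α t) P + l ≤ HHmax
    loss-in-H H+l≤ = subst (λ m → m + l ≤ HHmax) (sym (cut-HHgraph P))
      (+-slackˡ {cut (Hgraph n D) P} H+l≤ (+-mono-≤ (xCut≤ P) (yCut≤ P)))

    loss-in-x : 1 ≤ n → xCut P + l ≤ xMax → cut (HHgraph n D α t) P + l ≤ HHmax
    loss-in-x 1≤n x+l≤ = subst (λ m → m + l ≤ HHmax) (sym (cut-HHgraph P))
      (+-slackʳ (Hgraph-cut≤ 1≤n P) (+-slackˡ {xCut P} x+l≤ (yCut≤ P)))

    loss-in-y : 1 ≤ n → yCut P + l ≤ yMax → cut (HHgraph n D α t) P + l ≤ HHmax
    loss-in-y 1≤n y+l≤ = subst (λ m → m + l ≤ HHmax) (sym (cut-HHgraph P))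
      (+-slackʳ (Hgraph-cut≤ 1≤n P) (+-slackʳ {xCut P} (xCut≤ P) y+l≤))

  D²≤C : 1 ≤ n → D ^ 2 ≤ C
  D²≤C 1≤n = ≤-trans (m≤m*n (D ^ 2) (2 * n choose 2) {{>-nonZero (1≤choose2 (*-monoʳ-≤ 2 1≤n))}}) (m≤m+n _ 1)

  x-loss : ∀ P {i} → i ∈ [1… t ] → P (p i D) ≢ P (x i) → xCut P + C ≤ xMax
  x-loss P {i} i∈ P≢ =
    ∑+e≤m*c t C (λ {i} _ → Fgad-cut≤ (fx i) (p i D) (x i) P) i∈ (Fgad-cut+C≤ (fx i) (p i D) (x i) P P≢)

  r-loss : ∀ P {i} → i ∈ [1… n ∸ α ] → P (r i) ≢ P y → yCut P + C ≤ yMax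
  r-loss P {i} i∈ P≢ = ∑+e≤m*c (n ∸ α) C (yGadget-cut≤ P) i∈
    (+-slackˡ {cut (rGadget i) P} (Fgad-cut+C≤ (fr i) (r i) y P P≢)
                                  (Tgad-cut≤C*8 (t1 i) (t2 i) (t3 i) (p (n + i) D) (r i) z P))

  t-loss : ∀ P {i} → i ∈ [1… n ∸ α ] → P (p (n + i) D) ≡ P z → P (r i) ≡ P z → yCut P + C ≤ yMax
  t-loss P {i} i∈ Pp≡Pz Pr≡Pz = ∑+e≤m*c (n ∸ α) C (yGadget-cut≤ P) i∈
    (+-slackʳ {cut (rGadget i) P} (Fgad-cut≤ (fr i) (r i) y P)
                                  (Tgad-cut+C≤ (t1 i) (t2 i) (t3 i) (p (n + i) D) (r i) z P Pp≡Pz Pr≡Pz))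

  -- Unless every x-gadget and r-gadget joins equally coloured endpoints and every p_{n+i,D} lies in V₁,
  -- some gadget loses C ≥ D²; otherwise more than n columns lie in V₁, which unbalances H.
  HHgraph-cut+D²≤ : 1 ≤ n → t ≤ n → ∀ P → P y ≡ false → P z ≡ false → α + 1 ≤ countX P t →
                    cut (HHgraph n D α t) P + D ^ 2 ≤ HHmax
  HHgraph-cut+D²≤ 1≤n t≤n P Py Pz α+1≤count with monochromatic-or-defect P
  ... | inj₂ (_ , _ , i∈ , j∈ , P≢) = loss-in-H P (Hgraph-cut+D²≤-defect 1≤n P i∈ j∈ P≢)
  ... | inj₁ mono with all-or-counterexample (λ i → P (p i D) ≟ P (x i)) [1… t ]
  ...   | inj₂ (_ , i∈ , P≢) = loss-in-x P 1≤n (≤-trans (+-monoʳ-≤ _ (D²≤C 1≤n)) (x-loss P i∈ P≢))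
  ...   | inj₁ xs≡ with all-or-counterexample (λ i → P (r i) ≟ P y) [1… n ∸ α ]
  ...     | inj₂ (_ , i∈ , P≢) = loss-in-y P 1≤n (≤-trans (+-monoʳ-≤ _ (D²≤C 1≤n)) (r-loss P i∈ P≢))
  ...     | inj₁ rs≡ with all-or-counterexample (λ i → P (p (n + i) D) ≟ true) [1… n ∸ α ]
  ...       | inj₂ (_ , i∈ , P≢) = loss-in-y P 1≤n (≤-trans (+-monoʳ-≤ _ (D²≤C 1≤n))
                (t-loss P i∈ (trans (¬-not P≢) (sym Pz)) (trans (All.lookup rs≡ i∈) (trans Py (sym Pz)))))
  ...       | inj₁ highs = loss-in-H P (Hgraph-cut+D²≤-unbalanced P mono (n<trues t≤n α<T highs))
    where
    α<T : α < trues (colourOf P) t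
    α<T = ≤-trans (≤-reflexive (+-comm 1 α)) (≤-trans α+1≤count (≤-reflexive
            (∑-cong [1… t ] λ i∈ → cong ind (sym (All.lookup xs≡ i∈)))))

  HHgraph-closed : Closed (HHgraph n D α t)
  HHgraph-closed = Closed-∪ Hgraph-closed (Closed-∪ {graph (y ∷ z ∷ map x [1… t ]) []} []
    (Closed-∪ (Closed-⋃ (map⁺ (All.universal (λ i → Fgad-closed (fx i) (p i D) (x i)) [1… t ])))
              (Closed-⋃ (map⁺ (All.universal (λ i → Closed-∪ {graph (r i ∷ []) []} []
                 (Closed-∪ (Fgad-closed (fr i) (r i) y) (Tgad-closed (t1 i) (t2 i) (t3 i) (p (n + i) D) (r i) z)))
                 [1… n ∸ α ])))))

module OptimalExtension (n D α t : ℕ) (t≤n : t ≤ n) (Q : Partition) where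
  open HHGraph n D α t

  k : ℕ
  k = countX Q t

  k≤n : k ≤ n
  k≤n = ≤-trans (≤-trans (∑≤m*c t (λ _ → ind≤1 _)) (≤-reflexive (*-identityʳ t))) t≤n

  -- Columns 1..t copy the colours of the x_i, columns n+1..n+(n-k) lie in V₁, so exactly n columns do.
  colour : ℕ → Bool
  colour i = if does (i ≤? n) then does (i ≤? t) ∧ Q (x i) else does (i ∸ n ≤? n ∸ k)

  terminals : Partition
  terminals (p i j) = colour i
  terminals (x i)   = Q (x i)
  terminals z       = Q z
  terminals _       = false

  optimal : Partition
  optimal = extend terminals

  colour-low : ∀ {i} → i ≤ t → colour i ≡ Q (x i)
  colour-low {i} i≤t rewrite dec-true (i ≤? n) (≤-trans i≤t t≤n) | dec-true (i ≤? t) i≤t = refl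

  colour-mid : ∀ {i} → t < i → i ≤ n → colour i ≡ false
  colour-mid {i} t<i i≤n rewrite dec-true (i ≤? n) i≤n | dec-false (i ≤? t) (<⇒≱ t<i) = refl

  colour-high : ∀ {i} → 1 ≤ i → colour (n + i) ≡ does (i ≤? n ∸ k)
  colour-high {i} 1≤i rewrite dec-false (n + i ≤? n) (<⇒≱ (m<m+n n 1≤i)) | m+n∸m≡n n i = refl

  trues-colour : trues colour (2 * n) ≡ n
  trues-colour = begin
    trues colour (2 * n)                                        ≡⟨ cong (trues colour) (cong (n +_) (+-identityʳ n)) ⟩
    trues colour (n + n)                                        ≡⟨ ∑-[1…+] n n (ind ∘ colour) ⟩
    trues colour n + ∑[ i ∈ [1… n ] ] ind (colour (n + i))      ≡⟨ cong₂ _+_ low-half high-half ⟩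
    k + (n ∸ k)                                                 ≡⟨ m+[n∸m]≡n k≤n ⟩
    n                                                           ∎
    where
    open ≡-Reasoning
    low-half : trues colour n ≡ k
    low-half = begin
      trues colour n   ≡⟨ ∑-[1…]-truncate (ind ∘ colour) t≤n (λ t<i i≤n → cong ind (colour-mid t<i i≤n)) ⟩
      trues colour t   ≡⟨ ∑-cong [1… t ] (λ i∈ → cong ind (colour-low (proj₂ (∈-[1…]⁻ i∈)))) ⟩
      k                ∎
    high-half : ∑[ i ∈ [1… n ] ] ind (colour (n + i)) ≡ n ∸ k
    high-half = begin
      ∑[ i ∈ [1… n ] ] ind (colour (n + i))
        ≡⟨ ∑-cong [1… n ] (λ i∈ → cong ind (colour-high (proj₁ (∈-[1…]⁻ i∈)))) ⟩
      ∑[ i ∈ [1… n ] ] ind (does (i ≤? n ∸ k))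
        ≡⟨ ∑-[1…]-truncate (λ i → ind (does (i ≤? n ∸ k))) (m∸n≤m n k)
             (λ {i} n∸k<i _ → cong ind (dec-false (i ≤? n ∸ k) (<⇒≱ n∸k<i))) ⟩
      ∑[ i ∈ [1… n ∸ k ] ] ind (does (i ≤? n ∸ k))
        ≡⟨ ∑≡m*c (n ∸ k) (λ i∈ → cong ind (dec-true (_ ≤? n ∸ k) (proj₂ (∈-[1…]⁻ i∈)))) ⟩
      (n ∸ k) * 1
        ≡⟨ *-identityʳ (n ∸ k) ⟩
      n ∸ k
        ∎

  optimal-cut : (∀ {i} → i ∈ [1… n ∸ α ] → colour (n + i) ≡ true ⊎ Q z ≡ true) →
                cut (HHgraph n D α t) optimal ≡ HHmax
  optimal-cut high-or-z =
    trans (cut-HHgraph optimal) (cong₂ _+_ H-part (cong₂ _+_ x-part y-part))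
    where
    H-part : cut (Hgraph n D) optimal ≡ Hmax
    H-part = Hgraph-cut≡ optimal (λ _ _ → refl) refl trues-colour
    x-part : xCut optimal ≡ xMax
    x-part = ∑≡m*c t λ {i} i∈ →
      Fgad-cut≡ (fx i) (p i D) (x i) optimal (colour-low (proj₂ (∈-[1…]⁻ i∈))) (λ _ → refl)
    y-part : yCut optimal ≡ yMax
    y-part = ∑≡m*c (n ∸ α) λ {i} i∈ → cong₂ _+_
      (Fgad-cut≡ (fr i) (r i) y optimal refl (λ _ → refl))
      (trans (Tgad-cut≡ (t1 i) (t2 i) (t3 i) (p (n + i) D) (r i) z optimal
                (λ _ → refl) (λ _ → refl) (λ _ → refl) (λ _ → refl) (λ _ → refl) (λ _ → refl))
             (cong (λ m → C * (6 + m)) (triangle≡2 (high-or-z i∈))))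

  high-columns : k ≤ α → ∀ {i} → i ∈ [1… n ∸ α ] → colour (n + i) ≡ true
  high-columns k≤α i∈ with 1≤i , i≤n∸α ← ∈-[1…]⁻ i∈ =
    trans (colour-high 1≤i) (dec-true (_ ≤? n ∸ k) (≤-trans i≤n∸α (∸-monoʳ-≤ n k≤α)))

module _ (n D α t : ℕ) (1≤n : 1 ≤ n) (t≤n : t ≤ n) where
  open HHGraph n D α t

  private
    onlyZ : Partition
    onlyZ z = true
    onlyZ _ = false

    module Z = OptimalExtension n D α t t≤n onlyZ

  mcut-Hgraph : mcut (Hgraph n D) ≡ Hmax
  mcut-Hgraph = mcut≡ Hgraph-closed (Hgraph-cut≤ 1≤n) Z.optimal
    (Hgraph-cut≡ Z.optimal (λ _ _ → refl) refl Z.trues-colour)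

  mcut-HHgraph : mcut (HHgraph n D α t) ≡ HHmax
  mcut-HHgraph = mcut≡ HHgraph-closed (HHgraph-cut≤ 1≤n) Z.optimal (Z.optimal-cut λ _ → inj₂ refl)

  mcut-HHgraph≡ : mcut (HHgraph n D α t)
                  ≡ mcut (Hgraph n D) + (t + (n ∸ α)) * mcut (Fgraph n D) + (n ∸ α) * mcut (Tgraph n D)
  mcut-HHgraph≡ rewrite mcut-HHgraph | mcut-Hgraph | mcut-Fgraph | mcut-Tgraph = regroup Hmax t (n ∸ α) C
    where
    regroup : ∀ h a b c → h + (a * (c * 2) + b * (c * 2 + c * 8)) ≡ h + (a + b) * (c * 2) + b * (c * 8)
    regroup = solve-∀

  unbalanced-loses-D² : ∀ P → P y ≡ false → P z ≡ false → α + 1 ≤ countX P t →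
                        cut (HHgraph n D α t) P + D ^ 2 ≤ mcut (HHgraph n D α t)
  unbalanced-loses-D² P Py Pz α+1≤count =
    subst (cut (HHgraph n D α t) P + D ^ 2 ≤_) (sym mcut-HHgraph) (HHgraph-cut+D²≤ 1≤n t≤n P Py Pz α+1≤count)

  optimal⇒countX≤α : 1 ≤ D → ∀ P → Optimal (HHgraph n D α t) P → P y ≡ false → P z ≡ false →
                     countX P t ≤ α
  optimal⇒countX≤α 1≤D P opt Py Pz = ≮⇒≥ λ α<count → <-irrefl refl (begin-strict
    cut (HHgraph n D α t) P          <⟨ m<m+n _ (*-mono-≤ 1≤D (*-mono-≤ 1≤D ≤-refl)) ⟩
    cut (HHgraph n D α t) P + D ^ 2  ≤⟨ unbalanced-loses-D² P Py Pz (subst (_≤ countX P t) (+-comm 1 α) α<count) ⟩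
    mcut (HHgraph n D α t)           ≡⟨ opt ⟨
    cut (HHgraph n D α t) P          ∎)
    where open ≤-Reasoning

  extends-to-optimal : ∀ Q → (Q y ≡ false × Q z ≡ false × countX Q t ≤ α) ⊎ (Q y ≡ false × Q z ≡ true) →
                       Σ Partition λ P → Optimal (HHgraph n D α t) P
                         × ((i : ℕ) → 1 ≤ i → i ≤ t → P (x i) ≡ Q (x i)) × P y ≡ Q y × P z ≡ Q z
  extends-to-optimal Q (inj₁ (Qy≡false , _ , k≤α)) =
    optimal , trans (optimal-cut (inj₁ ∘ high-columns k≤α)) (sym mcut-HHgraph)
            , (λ _ _ _ → refl) , sym Qy≡false , refl
    where open OptimalExtension n D α t t≤n Q
  extends-to-optimal Q (inj₂ (Qy≡false , Qz≡true)) =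
    optimal , trans (optimal-cut (λ _ → inj₂ Qz≡true)) (sym mcut-HHgraph)
            , (λ _ _ _ → refl) , sym Qy≡false , refl
    where open OptimalExtension n D α t t≤n Q

mainTheorem5 : (n D α t : ℕ) → 1 ≤ D → 1 ≤ α → α ≤ t → t ≤ n →
    -- (1)
    (mcut (HHgraph n D α t)
       ≡ mcut (Hgraph n D) + (t + (n ∸ α)) * mcut (Fgraph n D) + (n ∸ α) * mcut (Tgraph n D))
    -- (2)
    × ((P : Partition) → Optimal (HHgraph n D α t) P → P y ≡ false → P z ≡ false →
         countX P t ≤ α)
    -- (3)
    × ((Q : Partition) →
         ((Q y ≡ false × Q z ≡ false × countX Q t ≤ α) ⊎ (Q y ≡ false × Q z ≡ true)) →
         Σ Partition (λ P → Optimal (HHgraph n D α t) P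
           × ((i : ℕ) → 1 ≤ i → i ≤ t → P (x i) ≡ Q (x i))
           × P y ≡ Q y × P z ≡ Q z))
    -- (4)
    × ((P : Partition) → P y ≡ false → P z ≡ false → α + 1 ≤ countX P t →
         cut (HHgraph n D α t) P + D ^ 2 ≤ mcut (HHgraph n D α t))
mainTheorem5 n D α t 1≤D 1≤α α≤t t≤n =
  mcut-HHgraph≡ n D α t 1≤n t≤n , optimal⇒countX≤α n D α t 1≤n t≤n 1≤D ,
  extends-to-optimal n D α t 1≤n t≤n , unbalanced-loses-D² n D α t 1≤n t≤n
  where
  1≤n : 1 ≤ n
  1≤n = ≤-trans 1≤α (≤-trans α≤t t≤n)
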